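{- For any FRACTRAN program $Q$ and any $f,g:(\mathbb N\to\mathbb N)\to\mathbb N$, one can compute a map which, given Diophantine witnesses for $f$ and $g$, produces a Diophantine witness for the relation $\nu\mapsto\bigl(Q:f\nu\succ g\nu\bigr)$.
   Context: A FRACTRAN program is a list of pairs $(p,q)\in\mathbb N^2$, written $p/q$. The step relation $Q:x\succ y$ is defined inductively. - $(p/q::Q'):x\succ y$ if $qy=px$. - $(p/q::Q'):x\succ y$ if $q\nmid px$ and $Q':x\succ y$. The empty program has no steps. Diophantine logic formulas are $A,B::= x_i\doteq n\mid x_i\doteq x_j\mid x_i\doteq x_j\dot+x_k\mid x_i\doteq x_j\dot\times x_k\mid A\dot\wedge B\mid A\dot\vee B\mid\dot\exists A$ (De Bruijn indices). For a valuation $\nu:\mathbb N\to\mathbb N$ the semantics is as follows. - Atoms have their obvious meaning. - $\dot\wedge$ and $\dot\vee$ are interpreted as $\wedge$ and $\vee$. - $[\![\dot\exists A]\!]\nu\iff\exists n,\ [\![A]\!](n\cdot\nu)$, with $(n\cdot\nu)(0)=n$ and $(n\cdot\nu)(i+1)=\nu(i)$. A Diophantine witness for a relation $S$ on valuations is a formula $A$ with $[\![A]\!]\nu\leftrightarrow S\,\nu$ for all $\nu$. A Diophantine witness for $f:(\mathbb N\to\mathbb N)\to\mathbb N$ is one for the relation $\nu\mapsto\nu(0)=f(\uparrow\nu)$, where $(\uparrow\nu)(i)=\nu(i+1)$. -}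

module Defs where

open import Data.Nat using (ℕ; zero; suc; _+_; _*_)
open import Data.Nat.Divisibility using (_∣_; _∤_)
open import Data.List using (List; []; _∷_)
open import Data.Product using (Σ; _×_; _,_; ∃)
open import Data.Sum using (_⊎_)
open import Relation.Binary.PropositionalEquality using (_≡_)
open import Function.Bundles using (_⇔_)

-- A FRACTRAN program: list of pairs (p , q), read as the fraction p/q.
FractranProg : Set
FractranProg = List (ℕ × ℕ)

data _∶_≻_ : FractranProg → ℕ → ℕ → Set where
  ≻-here : ∀ {p q Q x y} → q * y ≡ p * x → ((p , q) ∷ Q) ∶ x ≻ y
  ≻-next : ∀ {p q Q x y} → q ∤ p * x → Q ∶ x ≻ y → ((p , q) ∷ Q) ∶ x ≻ y

-- Diophantine logic formulas with De Bruijn indices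
data DioForm : Set where
  dio-cst : ℕ → ℕ → DioForm
  dio-eq  : ℕ → ℕ → DioForm
  dio-add : ℕ → ℕ → ℕ → DioForm
  dio-mul : ℕ → ℕ → ℕ → DioForm
  dio-and : DioForm → DioForm → DioForm
  dio-or  : DioForm → DioForm → DioForm
  dio-ex  : DioForm → DioForm

Valuation : Set
Valuation = ℕ → ℕ

_·_ : ℕ → Valuation → Valuation
(n · ν) zero = n
(n · ν) (suc i) = ν i

↑ : Valuation → Valuation
↑ ν i = ν (suc i)

⟦_⟧ : DioForm → Valuation → Set
⟦ dio-cst i n ⟧ ν = ν i ≡ n
⟦ dio-eq i j ⟧ ν = ν i ≡ ν j
⟦ dio-add i j k ⟧ ν = ν i ≡ ν j + ν k
⟦ dio-mul i j k ⟧ ν = ν i ≡ ν j * ν k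
⟦ dio-and A B ⟧ ν = ⟦ A ⟧ ν × ⟦ B ⟧ ν
⟦ dio-or A B ⟧ ν = ⟦ A ⟧ ν ⊎ ⟦ B ⟧ ν
⟦ dio-ex A ⟧ ν = ∃ λ n → ⟦ A ⟧ (n · ν)

DioWitnessRel : (Valuation → Set) → Set
DioWitnessRel S = Σ DioForm λ A → ∀ ν → ⟦ A ⟧ ν ⇔ S ν

DioWitnessFun : (Valuation → ℕ) → Set
DioWitnessFun f = DioWitnessRel λ ν → ν zero ≡ f (↑ ν)

-- A FRACTRAN step Q : x ≻ y unfolds, fraction by fraction, into a finite
-- combination of equations q * y ≡ p * x, non-divisibility conditions q ∤ p * x,
-- conjunctions and disjunctions. Each ingredient is Diophantine: q ∤ m holds iff
-- m leaves a nonzero remainder r + 1 < q (or q = 0 and m ≠ 0), which is an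
-- existential statement about sums and products. Diophantine relations are
-- closed under the logical connectives and under substituting Diophantine
-- functions, so the step relation is Diophantine by induction on Q.
module Submission where

open import Defs
open import Data.Nat using (ℕ; zero; suc; _+_; _*_; _≤_; _<_)
open import Data.Nat.Properties using (+-comm; m≤m+n; m≤n⇒∃[o]m+o≡n; <⇒≱; 0≢1+n; m+1+n≢0)
open import Data.Nat.Divisibility using (_∤_; ∣-refl; ∣⇒≤; 0∣⇒≡0; ∣m+n∣m⇒∣n; n∣m*n; m%n≡0⇒n∣m)
open import Data.Nat.DivMod using (_%_; _/_; m≡m%n+[m/n]*n; m%n<n)
open import Data.List using ([]; _∷_)
open import Data.Product using (_×_; _,_; ∃; ∃₂; map₂)
open import Data.Product.Function.NonDependent.Propositional using (_×-⇔_)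
open import Data.Sum using (_⊎_; inj₁; inj₂)
open import Data.Sum.Function.Propositional using (_⊎-⇔_)
open import Data.Empty using (⊥; ⊥-elim)
open import Relation.Binary.PropositionalEquality using (_≡_; refl; sym; trans; cong; subst; module ≡-Reasoning)
open import Function using (_$_)
open import Function.Bundles using (_⇔_; mk⇔; Equivalence)
open import Function.Construct.Identity using (⇔-id)
open import Function.Construct.Composition using (_⇔-∘_)

private
  variable
    S T : Valuation → Set
    f g h d : Valuation → ℕ

∃-⇔ : {A B : ℕ → Set} → (∀ n → A n ⇔ B n) → ∃ A ⇔ ∃ B
∃-⇔ A⇔B = mk⇔ (map₂ (Equivalence.to (A⇔B _))) (map₂ (Equivalence.from (A⇔B _)))

lift : (ℕ → ℕ) → ℕ → ℕ
lift ρ zero = zero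
lift ρ (suc i) = suc (ρ i)

rename : (ℕ → ℕ) → DioForm → DioForm
rename ρ (dio-cst i n) = dio-cst (ρ i) n
rename ρ (dio-eq i j) = dio-eq (ρ i) (ρ j)
rename ρ (dio-add i j k) = dio-add (ρ i) (ρ j) (ρ k)
rename ρ (dio-mul i j k) = dio-mul (ρ i) (ρ j) (ρ k)
rename ρ (dio-and A B) = dio-and (rename ρ A) (rename ρ B)
rename ρ (dio-or A B) = dio-or (rename ρ A) (rename ρ B)
rename ρ (dio-ex A) = dio-ex (rename (lift ρ) A)

⟦rename⟧ : ∀ A ρ {ν ν′ : Valuation} → (∀ i → ν (ρ i) ≡ ν′ i) → ⟦ rename ρ A ⟧ ν ⇔ ⟦ A ⟧ ν′
⟦rename⟧ (dio-cst i n) ρ eq rewrite eq i = ⇔-id _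
⟦rename⟧ (dio-eq i j) ρ eq rewrite eq i | eq j = ⇔-id _
⟦rename⟧ (dio-add i j k) ρ eq rewrite eq i | eq j | eq k = ⇔-id _
⟦rename⟧ (dio-mul i j k) ρ eq rewrite eq i | eq j | eq k = ⇔-id _
⟦rename⟧ (dio-and A B) ρ eq = ⟦rename⟧ A ρ eq ×-⇔ ⟦rename⟧ B ρ eq
⟦rename⟧ (dio-or A B) ρ eq = ⟦rename⟧ A ρ eq ⊎-⇔ ⟦rename⟧ B ρ eq
⟦rename⟧ (dio-ex A) ρ {ν} {ν′} eq = ∃-⇔ λ n → ⟦rename⟧ A (lift ρ) (lift-eq n)
  where
  lift-eq : ∀ n i → (n · ν) (lift ρ i) ≡ (n · ν′) i
  lift-eq n zero = refl
  lift-eq n (suc i) = eq i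

dio-⇔ : DioWitnessRel S → (∀ ν → S ν ⇔ T ν) → DioWitnessRel T
dio-⇔ (A , A⇔S) S⇔T = A , λ ν → S⇔T ν ⇔-∘ A⇔S ν

dio-⊥ : DioWitnessRel (λ _ → ⊥)
dio-⊥ = dio-and (dio-cst 0 0) (dio-cst 0 1) , λ ν →
  mk⇔ (λ (ν0≡0 , ν0≡1) → 0≢1+n (trans (sym ν0≡0) ν0≡1)) λ ()

dio-× : DioWitnessRel S → DioWitnessRel T → DioWitnessRel (λ ν → S ν × T ν)
dio-× (A , A⇔S) (B , B⇔T) = dio-and A B , λ ν → A⇔S ν ×-⇔ B⇔T ν

dio-⊎ : DioWitnessRel S → DioWitnessRel T → DioWitnessRel (λ ν → S ν ⊎ T ν)
dio-⊎ (A , A⇔S) (B , B⇔T) = dio-or A B , λ ν → A⇔S ν ⊎-⇔ B⇔T ν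

dio-∃ : DioWitnessRel S → DioWitnessRel (λ ν → ∃ λ n → S (n · ν))
dio-∃ (A , A⇔S) = dio-ex A , λ ν → ∃-⇔ λ n → A⇔S (n · ν)

-- A record, unlike DioWitnessFun f, determines f by unification.
record DioFun (f : Valuation → ℕ) : Set where
  constructor dio-fun
  field witness : DioWitnessFun f

dio-subst : {K : Valuation → Set} → DioFun f → DioWitnessRel K →
            DioWitnessRel (λ ν → K (f ν · ν))
dio-subst {f = f} {K = K} (dio-fun (A , A⇔f)) (B , B⇔K) = dio-ex (dio-and A B) , λ ν → mk⇔
  (λ (x , a , b) → subst (λ y → K (y · ν)) (Equivalence.to (A⇔f (x · ν)) a)
                                          (Equivalence.to (B⇔K (x · ν)) b))
  (λ k → f ν , Equivalence.from (A⇔f (f ν · ν)) refl , Equivalence.from (B⇔K (f ν · ν)) k)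

dio-weaken : DioFun f → DioFun (λ ν → f (↑ ν))
dio-weaken (dio-fun (A , A⇔f)) = dio-fun $ rename (lift suc) A , λ ν →
  A⇔f (ν 0 · ↑ (↑ ν)) ⇔-∘ ⟦rename⟧ A (lift suc) (skip-1 ν)
  where
  skip-1 : ∀ ν i → ν (lift suc i) ≡ (ν 0 · ↑ (↑ ν)) i
  skip-1 ν zero = refl
  skip-1 ν (suc i) = refl

dio-const : ∀ c → DioFun (λ _ → c)
dio-const c = dio-fun $ dio-cst 0 c , λ ν → ⇔-id _

dio-var : ∀ i → DioFun (λ ν → ν i)
dio-var i = dio-fun $ dio-eq 0 (suc i) , λ ν → ⇔-id _

-- The atom B speaks about the result (variable 2) and the two operands bound on top of it.
dio-op : (_∙_ : ℕ → ℕ → ℕ) → DioWitnessRel (λ ν → ν 2 ≡ ν 1 ∙ ν 0) →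
         DioFun f → DioFun g → DioFun (λ ν → f ν ∙ g ν)
dio-op _∙_ B F G = dio-fun $ dio-subst (dio-weaken F) (dio-subst (dio-weaken (dio-weaken G)) B)

dio-+ : DioFun f → DioFun g → DioFun (λ ν → f ν + g ν)
dio-+ = dio-op _+_ (dio-add 2 1 0 , λ ν → ⇔-id _)

dio-* : DioFun f → DioFun g → DioFun (λ ν → f ν * g ν)
dio-* = dio-op _*_ (dio-mul 2 1 0 , λ ν → ⇔-id _)

dio-≡ : DioFun f → DioFun g → DioWitnessRel (λ ν → f ν ≡ g ν)
dio-≡ F G = dio-subst F (dio-subst (dio-weaken G) (dio-eq 1 0 , λ ν → ⇔-id _))

dio-≤ : DioFun f → DioFun g → DioWitnessRel (λ ν → f ν ≤ g ν)
dio-≤ {f = f} {g = g} F G =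
  dio-⇔ (dio-∃ (dio-≡ (dio-+ (dio-weaken F) (dio-var 0)) (dio-weaken G))) λ ν →
    mk⇔ (λ (o , f+o≡g) → subst (f ν ≤_) f+o≡g (m≤m+n (f ν) o)) (λ f≤g → m≤n⇒∃[o]m+o≡n f≤g)

NonzeroRemainder : ℕ → ℕ → Set
NonzeroRemainder q m = ∃₂ λ a r → m ≡ a * q + suc r × (q ≡ 0 ⊎ suc r < q)

nonzeroRemainder⇒∤ : ∀ {q m} → NonzeroRemainder q m → q ∤ m
nonzeroRemainder⇒∤ (a , r , refl , inj₁ refl) 0∣m = m+1+n≢0 (a * 0) (0∣⇒≡0 0∣m)
nonzeroRemainder⇒∤ (a , r , refl , inj₂ r<q) q∣m = <⇒≱ r<q (∣⇒≤ (∣m+n∣m⇒∣n q∣m (n∣m*n a)))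

∤⇒nonzeroRemainder : ∀ q m → q ∤ m → NonzeroRemainder q m
∤⇒nonzeroRemainder zero zero 0∤0 = ⊥-elim (0∤0 ∣-refl)
∤⇒nonzeroRemainder zero (suc m) _ = 0 , m , refl , inj₁ refl
∤⇒nonzeroRemainder q@(suc _) m q∤m with m % q in m%q≡
... | zero = ⊥-elim (q∤m (m%n≡0⇒n∣m m q m%q≡))
... | suc r = m / q , r , m≡[m/q]*q+1+r , inj₂ (subst (_< q) m%q≡ (m%n<n m q))
  where
  open ≡-Reasoning
  m≡[m/q]*q+1+r : m ≡ m / q * q + suc r
  m≡[m/q]*q+1+r = begin
    m                  ≡⟨ m≡m%n+[m/n]*n m q ⟩
    m % q + m / q * q  ≡⟨ cong (_+ m / q * q) m%q≡ ⟩
    suc r + m / q * q  ≡⟨ +-comm (suc r) (m / q * q) ⟩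
    m / q * q + suc r  ∎

dio-∤ : DioFun d → DioFun h → DioWitnessRel (λ ν → d ν ∤ h ν)
dio-∤ {d = d} {h = h} D H = dio-⇔ (dio-∃ (dio-∃ (dio-×
  (dio-≡ H″ (dio-+ (dio-* (dio-var 1) D″) (dio-+ (dio-const 1) (dio-var 0))))
  (dio-⊎ (dio-≡ D″ (dio-const 0)) (dio-≤ (dio-+ (dio-const 2) (dio-var 0)) D″)))))
  λ ν → mk⇔ nonzeroRemainder⇒∤ (∤⇒nonzeroRemainder (d ν) (h ν))
  where
  D″ = dio-weaken (dio-weaken D)
  H″ = dio-weaken (dio-weaken H)

dio-≻ : ∀ Q → DioFun f → DioFun g → DioWitnessRel (λ ν → Q ∶ f ν ≻ g ν)
dio-≻ [] F G = dio-⇔ dio-⊥ λ ν → mk⇔ (λ ()) (λ ())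
dio-≻ ((p , q) ∷ Q) F G =
  dio-⇔ (dio-⊎ (dio-≡ (dio-* (dio-const q) G) (dio-* (dio-const p) F))
               (dio-× (dio-∤ (dio-const q) (dio-* (dio-const p) F)) (dio-≻ Q F G)))
    λ ν → mk⇔ (λ { (inj₁ e) → ≻-here e ; (inj₂ (q∤ , s)) → ≻-next q∤ s })
              (λ { (≻-here e) → inj₁ e ; (≻-next q∤ s) → inj₂ (q∤ , s) })

lemma7p1 : (Q : FractranProg) (f g : Valuation → ℕ) →
    DioWitnessFun f → DioWitnessFun g →
    DioWitnessRel (λ ν → Q ∶ f ν ≻ g ν)
lemma7p1 Q f g F G = dio-≻ Q (dio-fun F) (dio-fun G)
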